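{- Let $u,v\in\mathbb{P}^\ast$. If $u^+$ and $v^+$ are Wilf-equivalent, then $u$ and $v$ are Wilf-equivalent. Likewise, if $u^+$ and $v^+$ are strongly Wilf-equivalent, then $u$ and $v$ are strongly Wilf-equivalent.
   Context: $\mathbb{P}$ denotes the positive integers and $\mathbb{P}^\ast$ the set of finite words over $\mathbb{P}$. For a word $w=w_1\cdots w_n$, $|w|=n$ and $\|w\|=w_1+\cdots+w_n$. For $u\in\mathbb{P}^\ast$, $u^+$ is the word obtained by adding $1$ to every letter of $u$. A word $v$ dominates $u$ if $|v|=|u|$ and $v_i\ge u_i$ for all $i$; a factor of $w$ dominating $u$ is a contiguous subword of $w$ of length $|u|$ that dominates $u$ (counted by starting position). Let $A_u(x,y,z)=\sum_{w\in\mathbb{P}^\ast}x^{|w|}y^{\|w\|}z^{N_u(w)}$ where $N_u(w)$ is the number of factors of $w$ dominating $u$. Words $u,v$ are Wilf-equivalent if $A_u(x,y,0)=A_v(x,y,0)$, and strongly Wilf-equivalent if $A_u(x,y,z)=A_v(x,y,z)$. -}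

module Defs where

open import Data.Nat using (ℕ; zero; suc; _+_; _≤ᵇ_; _≡ᵇ_)
open import Data.Bool using (Bool; true; false; _∧_; if_then_else_)
open import Data.List using (List; []; _∷_; length; map; take; concatMap; upTo; filterᵇ)
open import Data.Nat.ListAction using (sum)
open import Relation.Binary.PropositionalEquality using (_≡_)

-- Words over ℙ are lists of naturals; positivity of letters is imposed
-- explicitly where needed (All (1 ≤_) u), and the enumerated words w
-- below only use letters in {1,…,b}.
Word : Set
Word = List ℕ

_⁺ : Word → Word
u ⁺ = map suc u

dominates : Word → Word → Bool
dominates [] [] = true
dominates (a ∷ v) (b ∷ u) = (b ≤ᵇ a) ∧ dominates v u
dominates _ _ = false

b2n : Bool → ℕ
b2n true = 1
b2n false = 0

-- N u w : number of starting positions i (0 ≤ i ≤ |w|) such that the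
-- factor of w of length |u| starting at i exists and dominates u.
N : Word → Word → ℕ
N u [] = b2n (dominates (take (length u) []) u)
N u (a ∷ w) = b2n (dominates (take (length u) (a ∷ w)) u) + N u w

wordsOf : ℕ → ℕ → List Word
wordsOf zero b = [] ∷ []
wordsOf (suc n) b = concatMap (λ a → map (a ∷_) (wordsOf n b)) (map suc (upTo b))

-- coeff u n m k = [x^n y^m z^k] A_u(x,y,z)
--   = #{ w ∈ ℙ* : |w| = n, ‖w‖ = m, N_u(w) = k }.
-- Every w ∈ ℙ* with ‖w‖ = m has all letters in {1,…,m}, so it suffices to
-- enumerate wordsOf n m.
coeff : Word → ℕ → ℕ → ℕ → ℕ
coeff u n m k = length (filterᵇ (λ w → (sum w ≡ᵇ m) ∧ (N u w ≡ᵇ k)) (wordsOf n m))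

-- A_u(x,y,0) = A_v(x,y,0), as equality of formal power series coefficients
WilfEquiv : Word → Word → Set
WilfEquiv u v = ∀ n m → coeff u n m 0 ≡ coeff v n m 0

StronglyWilfEquiv : Word → Word → Set
StronglyWilfEquiv u v = ∀ n m k → coeff u n m k ≡ coeff v n m k

module Submission where

open import Defs
open import Data.Nat using (ℕ; _≤_)
open import Data.List.Relation.Unary.All using (All)
open import Data.Product using (_×_)

open import Data.Bool using (Bool; true; false; _∧_)
open import Data.List using (List; []; _∷_; length; map; take; concatMap; upTo; applyUpTo; filterᵇ; _++_)
open import Data.List.Properties using (length-map; take-map; map-++; map-∘; map-cong; map-upTo)
open import Data.List.Relation.Unary.All using (_∷_)
open import Data.Nat using (zero; suc; _+_; _*_; _∸_; _<_; z≤n; s≤s; _≤ᵇ_; _≡ᵇ_; _≤?_)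
open import Data.Nat.ListAction using (sum)
open import Data.Nat.ListAction.Properties using (sum-++)
open import Data.Nat.Properties
open import Algebra.Properties.CommutativeSemigroup +-commutativeSemigroup using ()
  renaming (interchange to +-interchange; x∙yz≈y∙xz to +-exchangeˡ)
open import Data.Product using (_,_)
open import Relation.Binary.PropositionalEquality
open import Relation.Nullary using (yes; no)

-- Cut a word at its first letter 1: w = w₀ 1 w′ with w₀ free of 1. Every letter of u⁺ is
-- at least 2, so no factor dominating u⁺ covers that 1, and N(u⁺)(w₀ 1 w′) = N(u⁺)(w₀) +
-- N(u⁺)(w′). Hence A_{u⁺} = B + x y B A_{u⁺}, where B counts the 1-free words by the same
-- statistic, and this equation determines B from A_{u⁺}, coefficient by coefficient, by
-- induction on the length. The 1-free words are exactly the v⁺, with |v⁺| = |v|,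
-- ‖v⁺‖ = ‖v‖ + |v| and N(u⁺)(v⁺) = N(u)(v); so B(x,y,z) = A_u(xy,y,z) is determined as well.

sumAntidiag : ℕ → (ℕ → ℕ → ℕ) → ℕ
sumAntidiag zero    f = f 0 0
sumAntidiag (suc t) f = f 0 (suc t) + sumAntidiag t (λ x y → f (suc x) y)

sumAntidiag⁺ : ℕ → (ℕ → ℕ → ℕ) → ℕ
sumAntidiag⁺ zero    f = 0
sumAntidiag⁺ (suc t) f = sumAntidiag t (λ x y → f (suc x) y)

sumAntidiag-head : ∀ t f → sumAntidiag t f ≡ f 0 t + sumAntidiag⁺ t f
sumAntidiag-head zero    f = sym (+-identityʳ _)
sumAntidiag-head (suc t) f = refl

sumAntidiag-cong : ∀ t {f g : ℕ → ℕ → ℕ} → (∀ x y → x + y ≡ t → f x y ≡ g x y) →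
                   sumAntidiag t f ≡ sumAntidiag t g
sumAntidiag-cong zero    H = H 0 0 refl
sumAntidiag-cong (suc t) H =
  cong₂ _+_ (H 0 (suc t) refl) (sumAntidiag-cong t (λ x y x+y≡t → H (suc x) y (cong suc x+y≡t)))

sumAntidiag-zero : ∀ t {f : ℕ → ℕ → ℕ} → (∀ x y → x + y ≡ t → f x y ≡ 0) →
                   sumAntidiag t f ≡ 0
sumAntidiag-zero zero    H = H 0 0 refl
sumAntidiag-zero (suc t) H =
  cong₂ _+_ (H 0 (suc t) refl) (sumAntidiag-zero t (λ x y x+y≡t → H (suc x) y (cong suc x+y≡t)))

sumAntidiag⁺-zero : ∀ t {f : ℕ → ℕ → ℕ} → (∀ x y → suc x + y ≡ t → f (suc x) y ≡ 0) →
                    sumAntidiag⁺ t f ≡ 0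
sumAntidiag⁺-zero zero    H = refl
sumAntidiag⁺-zero (suc t) H = sumAntidiag-zero t (λ x y x+y≡t → H x y (cong suc x+y≡t))

sumAntidiag-+ : ∀ t f g → sumAntidiag t (λ x y → f x y + g x y) ≡ sumAntidiag t f + sumAntidiag t g
sumAntidiag-+ zero    f g = refl
sumAntidiag-+ (suc t) f g =
  trans (cong (f 0 (suc t) + g 0 (suc t) +_) (sumAntidiag-+ t _ _))
        (+-interchange (f 0 (suc t)) (g 0 (suc t)) _ _)

sumAntidiag-*ˡ : ∀ t c f → sumAntidiag t (λ x y → c * f x y) ≡ c * sumAntidiag t f
sumAntidiag-*ˡ zero    c f = refl
sumAntidiag-*ˡ (suc t) c f =
  trans (cong (c * f 0 (suc t) +_) (sumAntidiag-*ˡ t c _)) (sym (*-distribˡ-+ c (f 0 (suc t)) _))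

sumAntidiag-*ʳ : ∀ t c f → sumAntidiag t (λ x y → f x y * c) ≡ sumAntidiag t f * c
sumAntidiag-*ʳ zero    c f = refl
sumAntidiag-*ʳ (suc t) c f =
  trans (cong (f 0 (suc t) * c +_) (sumAntidiag-*ʳ t c _)) (sym (*-distribʳ-+ c (f 0 (suc t)) _))

sumAntidiag-comm : ∀ s t (F : ℕ → ℕ → ℕ → ℕ → ℕ) →
  sumAntidiag s (λ a b → sumAntidiag t (F a b)) ≡
  sumAntidiag t (λ c d → sumAntidiag s (λ a b → F a b c d))
sumAntidiag-comm zero    t F = refl
sumAntidiag-comm (suc s) t F =
  trans (cong (sumAntidiag t (F 0 (suc s)) +_) (sumAntidiag-comm s t _)) (sym (sumAntidiag-+ t _ _))

sumAntidiag-assoc : ∀ t (F : ℕ → ℕ → ℕ → ℕ) →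
  sumAntidiag t (λ x r → sumAntidiag r (λ y s → F x y s)) ≡
  sumAntidiag t (λ p s → sumAntidiag p (λ x y → F x y s))
sumAntidiag-assoc zero    F = refl
sumAntidiag-assoc (suc t) F = begin
  (F 0 0 (suc t) + A) + sumAntidiag t (λ x r → sumAntidiag r (λ y s → F (suc x) y s))
    ≡⟨ cong ((F 0 0 (suc t) + A) +_) (sumAntidiag-assoc t (λ x → F (suc x))) ⟩
  (F 0 0 (suc t) + A) + B
    ≡⟨ +-assoc (F 0 0 (suc t)) A B ⟩
  F 0 0 (suc t) + (A + B)
    ≡⟨ cong (F 0 0 (suc t) +_) (sym (sumAntidiag-+ t _ _)) ⟩
  F 0 0 (suc t) + sumAntidiag t (λ p s → F 0 (suc p) s + sumAntidiag p (λ x y → F (suc x) y s)) ∎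
  where
  open ≡-Reasoning
  A B : ℕ
  A = sumAntidiag t (λ y s → F 0 (suc y) s)
  B = sumAntidiag t (λ p s → sumAntidiag p (λ x y → F (suc x) y s))

sumAntidiag-shift : ∀ n e f → (∀ a r → r < n → f a r ≡ 0) →
                    sumAntidiag (e + n) f ≡ sumAntidiag e (λ a r → f a (n + r))
sumAntidiag-shift n zero f H = begin
  sumAntidiag n f                ≡⟨ sumAntidiag-head n f ⟩
  f 0 n + sumAntidiag⁺ n f       ≡⟨ cong (f 0 n +_) tail≡0 ⟩
  f 0 n + 0                      ≡⟨ +-identityʳ _ ⟩
  f 0 n                          ≡⟨ cong (f 0) (+-identityʳ n) ⟨
  f 0 (n + 0)                    ∎
  where
  open ≡-Reasoning
  tail≡0 : sumAntidiag⁺ n f ≡ 0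
  tail≡0 = sumAntidiag⁺-zero n (λ x y x+y≡n → H (suc x) y (subst (y <_) x+y≡n (s≤s (m≤n+m y x))))
sumAntidiag-shift n (suc e) f H =
  cong₂ _+_ (cong (f 0) (trans (cong suc (+-comm e n)) (sym (+-suc n e))))
            (sumAntidiag-shift n e (λ a → f (suc a)) (λ a → H (suc a)))

-- Words are summed over by length n and excess e = ‖w‖ ∸ n, so that a letter is suc a for an
-- arbitrary a : ℕ and positivity never has to be tracked.
sumWords : ℕ → ℕ → (Word → ℕ) → ℕ
sumWords zero    zero    g = g []
sumWords zero    (suc _) g = 0
sumWords (suc n) e       g = sumAntidiag e (λ a r → sumWords n r (λ w → g (suc a ∷ w)))

sumWords-cong : ∀ n e {f g : Word → ℕ} → (∀ w → f w ≡ g w) → sumWords n e f ≡ sumWords n e g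
sumWords-cong zero    zero    H = H []
sumWords-cong zero    (suc e) H = refl
sumWords-cong (suc n) e       H = sumAntidiag-cong e (λ a r _ → sumWords-cong n r (λ w → H (suc a ∷ w)))

sumWords-zero : ∀ n e {g : Word → ℕ} → (∀ w → g w ≡ 0) → sumWords n e g ≡ 0
sumWords-zero zero    zero    H = H []
sumWords-zero zero    (suc e) H = refl
sumWords-zero (suc n) e       H = sumAntidiag-zero e (λ a r _ → sumWords-zero n r (λ w → H (suc a ∷ w)))

sumWords-+ : ∀ n e f g → sumWords n e (λ w → f w + g w) ≡ sumWords n e f + sumWords n e g
sumWords-+ zero    zero    f g = refl
sumWords-+ zero    (suc e) f g = refl
sumWords-+ (suc n) e       f g =
  trans (sumAntidiag-cong e (λ a r _ → sumWords-+ n r _ _)) (sumAntidiag-+ e _ _)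

sumWords-*ˡ : ∀ n e c f → sumWords n e (λ w → c * f w) ≡ c * sumWords n e f
sumWords-*ˡ zero    zero    c f = refl
sumWords-*ˡ zero    (suc e) c f = sym (*-zeroʳ c)
sumWords-*ˡ (suc n) e       c f =
  trans (sumAntidiag-cong e (λ a r _ → sumWords-*ˡ n r c _)) (sumAntidiag-*ˡ e c _)

sumWords-*ʳ : ∀ n e c f → sumWords n e (λ w → f w * c) ≡ sumWords n e f * c
sumWords-*ʳ zero    zero    c f = refl
sumWords-*ʳ zero    (suc e) c f = refl
sumWords-*ʳ (suc n) e       c f =
  trans (sumAntidiag-cong e (λ a r _ → sumWords-*ʳ n r c _)) (sumAntidiag-*ʳ e c _)

sumWords-sumAntidiag : ∀ n e t (F : ℕ → ℕ → Word → ℕ) →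
  sumWords n e (λ w → sumAntidiag t (λ x y → F x y w)) ≡ sumAntidiag t (λ x y → sumWords n e (F x y))
sumWords-sumAntidiag n e zero    F = refl
sumWords-sumAntidiag n e (suc t) F =
  trans (sumWords-+ n e _ _) (cong (sumWords n e (F 0 (suc t)) +_) (sumWords-sumAntidiag n e t _))

oneFree : Word → ℕ
oneFree []                 = 1
oneFree (zero ∷ w)         = oneFree w
oneFree (suc zero ∷ w)     = 0
oneFree (suc (suc a) ∷ w)  = oneFree w

sumWords-1∷-oneFree : ∀ n e (h : Word → ℕ) → sumWords n e (λ w → oneFree (1 ∷ w) * h w) ≡ 0
sumWords-1∷-oneFree n e h = sumWords-zero n e (λ w → refl)

sumWords-oneFree-suc : ∀ n e (h : Word → ℕ) →
  sumWords (suc n) e (λ w → oneFree w * h w) ≡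
  sumAntidiag⁺ e (λ a r → sumWords n r (λ w → oneFree (suc a ∷ w) * h (suc a ∷ w)))
sumWords-oneFree-suc n e h =
  trans (sumAntidiag-head e F) (cong (_+ sumAntidiag⁺ e F) (sumWords-1∷-oneFree n e (λ w → h (1 ∷ w))))
  where
  F : ℕ → ℕ → ℕ
  F a r = sumWords n r (λ w → oneFree (suc a ∷ w) * h (suc a ∷ w))

-- A 1-free word of length n has all letters ≥ 2, hence excess ≥ n.
sumWords-oneFree-< : ∀ n r (h : Word → ℕ) → r < n → sumWords n r (λ w → oneFree w * h w) ≡ 0
sumWords-oneFree-< (suc n) r h r<n = sumAntidiag-zero r vanish
  where
  vanish : ∀ a r′ → a + r′ ≡ r →
           sumWords n r′ (λ w → oneFree (suc a ∷ w) * h (suc a ∷ w)) ≡ 0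
  vanish zero    r′ _      = sumWords-1∷-oneFree n r′ (λ w → h (1 ∷ w))
  vanish (suc a) r′ a+r′≡r = sumWords-oneFree-< n r′ (λ w → h (suc (suc a) ∷ w))
    (≤-trans (subst (suc r′ ≤_) a+r′≡r (s≤s (m≤n+m r′ a))) (≤-pred r<n))

sumWords-oneFree-⁺ : ∀ n e (h : Word → ℕ) →
  sumWords n (n + e) (λ w → oneFree w * h w) ≡ sumWords n e (λ w → h (w ⁺))
sumWords-oneFree-⁺ zero    zero    h = +-identityʳ _
sumWords-oneFree-⁺ zero    (suc e) h = refl
sumWords-oneFree-⁺ (suc n) e       h = begin
  sumWords (suc n) (suc n + e) (λ w → oneFree w * h w)
    ≡⟨ sumWords-oneFree-suc n (suc n + e) h ⟩
  sumAntidiag (n + e) F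
    ≡⟨ cong (λ t → sumAntidiag t F) (+-comm n e) ⟩
  sumAntidiag (e + n) F
    ≡⟨ sumAntidiag-shift n e F (λ a r → sumWords-oneFree-< n r _) ⟩
  sumAntidiag e (λ a r → F a (n + r))
    ≡⟨ sumAntidiag-cong e (λ a r _ → sumWords-oneFree-⁺ n r (λ w → h (suc (suc a) ∷ w))) ⟩
  sumWords (suc n) e (λ w → h (w ⁺)) ∎
  where
  open ≡-Reasoning
  F : ℕ → ℕ → ℕ
  F a r = sumWords n r (λ w → oneFree w * h (suc (suc a) ∷ w))

sumFirstOneAt : (Word → ℕ) → ℕ → ℕ → ℕ → ℕ → ℕ
sumFirstOneAt g j n′ e₀ e′ =
  sumWords j e₀ (λ w₀ → oneFree w₀ * sumWords n′ e′ (λ w′ → g (w₀ ++ 1 ∷ w′)))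

sumContainingOne : ℕ → ℕ → (Word → ℕ) → ℕ
sumContainingOne zero    e g = 0
sumContainingOne (suc n) e g = sumAntidiag n (λ j n′ → sumAntidiag e (sumFirstOneAt g j n′))

-- The part of sumContainingOne (suc n) e g coming from words with first letter suc a.
containingOneAfter : ℕ → (Word → ℕ) → ℕ → ℕ → ℕ
containingOneAfter n g zero    r = sumWords n r (λ w → g (1 ∷ w))
containingOneAfter n g (suc a) r = sumContainingOne n r (λ w → g (suc (suc a) ∷ w))

sumFirstOneAt-suc : ∀ g j n′ p e′ →
  sumFirstOneAt g (suc j) n′ (suc p) e′ ≡
  sumAntidiag p (λ a e₀ → sumFirstOneAt (λ w → g (suc (suc a) ∷ w)) j n′ e₀ e′)
sumFirstOneAt-suc g j n′ p e′ =
  sumWords-oneFree-suc j (suc p) (λ w₀ → sumWords n′ e′ (λ w′ → g (w₀ ++ 1 ∷ w′)))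

sumAntidiag⁺-containingOneAfter : ∀ n e g →
  sumAntidiag⁺ e (containingOneAfter n g) ≡
  sumAntidiag⁺ n (λ j n′ → sumAntidiag e (sumFirstOneAt g j n′))
sumAntidiag⁺-containingOneAfter zero    e       g = sumAntidiag⁺-zero e (λ _ _ _ → refl)
sumAntidiag⁺-containingOneAfter (suc n) zero    g =
  sym (sumAntidiag-zero n (λ j n′ _ →
    sumWords-oneFree-suc j 0 (λ w₀ → sumWords n′ 0 (λ w′ → g (w₀ ++ 1 ∷ w′)))))
sumAntidiag⁺-containingOneAfter (suc n) (suc e) g = begin
  sumAntidiag e (λ a r → sumAntidiag n (λ j n′ → sumAntidiag r (F a j n′)))
    ≡⟨ sumAntidiag-comm e n _ ⟩
  sumAntidiag n (λ j n′ → sumAntidiag e (λ a r → sumAntidiag r (F a j n′)))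
    ≡⟨ sumAntidiag-cong n (λ j n′ _ → sumAntidiag-assoc e (λ a → F a j n′)) ⟩
  sumAntidiag n (λ j n′ → sumAntidiag e (λ p e′ → sumAntidiag p (λ a e₀ → F a j n′ e₀ e′)))
    ≡⟨ sumAntidiag-cong n (λ j n′ _ →
         sumAntidiag-cong e (λ p e′ _ → sumFirstOneAt-suc g j n′ p e′)) ⟨
  sumAntidiag n (λ j n′ → sumAntidiag⁺ (suc e) (sumFirstOneAt g (suc j) n′))
    ≡⟨ sumAntidiag-cong n (λ j n′ _ → cong (_+ sumAntidiag⁺ (suc e) (sumFirstOneAt g (suc j) n′))
         (sumWords-oneFree-suc j 0 (λ w₀ → sumWords n′ (suc e) (λ w′ → g (w₀ ++ 1 ∷ w′))))) ⟨
  sumAntidiag n (λ j n′ → sumAntidiag (suc e) (sumFirstOneAt g (suc j) n′)) ∎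
  where
  open ≡-Reasoning
  F : ℕ → ℕ → ℕ → ℕ → ℕ → ℕ
  F a = sumFirstOneAt (λ w → g (suc (suc a) ∷ w))

sumContainingOne-suc : ∀ n e g → sumContainingOne (suc n) e g ≡ sumAntidiag e (containingOneAfter n g)
sumContainingOne-suc n e g = begin
  sumContainingOne (suc n) e g
    ≡⟨ sumAntidiag-head n _ ⟩
  sumAntidiag e (sumFirstOneAt g 0 n) + sumAntidiag⁺ n (λ j n′ → sumAntidiag e (sumFirstOneAt g j n′))
    ≡⟨ cong₂ _+_ firstLetterOne (sym (sumAntidiag⁺-containingOneAfter n e g)) ⟩
  containingOneAfter n g 0 e + sumAntidiag⁺ e (containingOneAfter n g)
    ≡⟨ sumAntidiag-head e _ ⟨
  sumAntidiag e (containingOneAfter n g) ∎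
  where
  open ≡-Reasoning
  firstLetterOne : sumAntidiag e (sumFirstOneAt g 0 n) ≡ sumWords n e (λ w → g (1 ∷ w))
  firstLetterOne = begin
    sumAntidiag e (sumFirstOneAt g 0 n)
      ≡⟨ sumAntidiag-head e _ ⟩
    (sumWords n e (λ w → g (1 ∷ w)) + 0) + sumAntidiag⁺ e (sumFirstOneAt g 0 n)
      ≡⟨ cong₂ _+_ (+-identityʳ _) (sumAntidiag⁺-zero e (λ _ _ _ → refl)) ⟩
    sumWords n e (λ w → g (1 ∷ w)) + 0
      ≡⟨ +-identityʳ _ ⟩
    sumWords n e (λ w → g (1 ∷ w)) ∎

sumWords-oneFree+containingOne : ∀ n e g →
  sumWords n e g ≡ sumWords n e (λ w → oneFree w * g w) + sumContainingOne n e g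
sumWords-oneFree+containingOne zero    zero    g = sym (trans (+-identityʳ _) (+-identityʳ _))
sumWords-oneFree+containingOne zero    (suc e) g = refl
sumWords-oneFree+containingOne (suc n) e       g = begin
  sumWords (suc n) e g
    ≡⟨ sumAntidiag-cong e (λ a r _ → byFirstLetter a r) ⟩
  sumAntidiag e (λ a r →
    sumWords n r (λ w → oneFree (suc a ∷ w) * g (suc a ∷ w)) + containingOneAfter n g a r)
    ≡⟨ sumAntidiag-+ e _ _ ⟩
  sumWords (suc n) e (λ w → oneFree w * g w) + sumAntidiag e (containingOneAfter n g)
    ≡⟨ cong (sumWords (suc n) e (λ w → oneFree w * g w) +_) (sumContainingOne-suc n e g) ⟨
  sumWords (suc n) e (λ w → oneFree w * g w) + sumContainingOne (suc n) e g ∎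
  where
  open ≡-Reasoning
  byFirstLetter : ∀ a r → sumWords n r (λ w → g (suc a ∷ w)) ≡
    sumWords n r (λ w → oneFree (suc a ∷ w) * g (suc a ∷ w)) + containingOneAfter n g a r
  byFirstLetter zero    r =
    sym (cong (_+ containingOneAfter n g 0 r) (sumWords-1∷-oneFree n r (λ w → g (1 ∷ w))))
  byFirstLetter (suc a) r = sumWords-oneFree+containingOne n r (λ w → g (suc (suc a) ∷ w))

δ : ℕ → ℕ → ℕ
δ x t = b2n (x ≡ᵇ t)

δ-+ : ∀ k x y → δ (x + y) k ≡ sumAntidiag k (λ k₀ k₁ → δ x k₀ * δ y k₁)
δ-+ zero    zero    y = sym (+-identityʳ _)
δ-+ zero    (suc x) y = refl
δ-+ (suc k) zero    y = sym (trans (cong₂ _+_ (+-identityʳ _) (sumAntidiag-zero k (λ _ _ _ → refl)))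
                                   (+-identityʳ _))
δ-+ (suc k) (suc x) y = δ-+ k x y

δ-+-cancelˡ : ∀ a x t → δ (a + x) (a + t) ≡ δ x t
δ-+-cancelˡ zero    x t = refl
δ-+-cancelˡ (suc a) x t = δ-+-cancelˡ a x t

δ-< : ∀ x t → t < x → δ x t ≡ 0
δ-< (suc x) zero    t<x = refl
δ-< (suc x) (suc t) t<x = δ-< x t (≤-pred t<x)

countBy : (Word → ℕ) → ℕ → ℕ → ℕ → ℕ
countBy s n e k = sumWords n e (λ w → δ (s w) k)

countOneFreeBy : (Word → ℕ) → ℕ → ℕ → ℕ → ℕ
countOneFreeBy s n e k = sumWords n e (λ w → oneFree w * δ (s w) k)

-- Coefficients of x B C: the separating letter 1 adds one to the length and nothing to the excess.
shiftedConv : (ℕ → ℕ → ℕ → ℕ) → (ℕ → ℕ → ℕ → ℕ) → ℕ → ℕ → ℕ → ℕ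
shiftedConv b c zero    e k = 0
shiftedConv b c (suc n) e k =
  sumAntidiag n (λ j n′ → sumAntidiag e (λ e₀ e′ →
    sumAntidiag k (λ k₀ k₁ → b j e₀ k₀ * c n′ e′ k₁)))

module _ (s : Word → ℕ) (s-additive : ∀ w₀ w′ → s (w₀ ++ 1 ∷ w′) ≡ s w₀ + s w′) where

  sumWords-after : ∀ k n′ e′ w₀ →
    sumWords n′ e′ (λ w′ → δ (s (w₀ ++ 1 ∷ w′)) k) ≡
    sumAntidiag k (λ k₀ k₁ → δ (s w₀) k₀ * countBy s n′ e′ k₁)
  sumWords-after k n′ e′ w₀ = begin
    sumWords n′ e′ (λ w′ → δ (s (w₀ ++ 1 ∷ w′)) k)
      ≡⟨ sumWords-cong n′ e′ (λ w′ →
           trans (cong (λ x → δ x k) (s-additive w₀ w′)) (δ-+ k (s w₀) (s w′))) ⟩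
    sumWords n′ e′ (λ w′ → sumAntidiag k (λ k₀ k₁ → δ (s w₀) k₀ * δ (s w′) k₁))
      ≡⟨ sumWords-sumAntidiag n′ e′ k _ ⟩
    sumAntidiag k (λ k₀ k₁ → sumWords n′ e′ (λ w′ → δ (s w₀) k₀ * δ (s w′) k₁))
      ≡⟨ sumAntidiag-cong k (λ k₀ k₁ _ → sumWords-*ˡ n′ e′ (δ (s w₀) k₀) _) ⟩
    sumAntidiag k (λ k₀ k₁ → δ (s w₀) k₀ * countBy s n′ e′ k₁) ∎
    where open ≡-Reasoning

  sumFirstOneAt-δ : ∀ k j n′ e₀ e′ →
    sumFirstOneAt (λ w → δ (s w) k) j n′ e₀ e′ ≡
    sumAntidiag k (λ k₀ k₁ → countOneFreeBy s j e₀ k₀ * countBy s n′ e′ k₁)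
  sumFirstOneAt-δ k j n′ e₀ e′ = begin
    sumWords j e₀ (λ w₀ → oneFree w₀ * sumWords n′ e′ (λ w′ → δ (s (w₀ ++ 1 ∷ w′)) k))
      ≡⟨ sumWords-cong j e₀ (λ w₀ → cong (oneFree w₀ *_) (sumWords-after k n′ e′ w₀)) ⟩
    sumWords j e₀ (λ w₀ → oneFree w₀ * sumAntidiag k (λ k₀ k₁ → δ (s w₀) k₀ * countBy s n′ e′ k₁))
      ≡⟨ sumWords-cong j e₀ (λ w₀ → trans (sym (sumAntidiag-*ˡ k (oneFree w₀) _))
           (sumAntidiag-cong k (λ k₀ k₁ _ → sym (*-assoc (oneFree w₀) _ _)))) ⟩
    sumWords j e₀ (λ w₀ → sumAntidiag k (λ k₀ k₁ → oneFree w₀ * δ (s w₀) k₀ * countBy s n′ e′ k₁))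
      ≡⟨ sumWords-sumAntidiag j e₀ k _ ⟩
    sumAntidiag k (λ k₀ k₁ → sumWords j e₀ (λ w₀ → oneFree w₀ * δ (s w₀) k₀ * countBy s n′ e′ k₁))
      ≡⟨ sumAntidiag-cong k (λ k₀ k₁ _ → sumWords-*ʳ j e₀ (countBy s n′ e′ k₁) _) ⟩
    sumAntidiag k (λ k₀ k₁ → countOneFreeBy s j e₀ k₀ * countBy s n′ e′ k₁) ∎
    where open ≡-Reasoning

  countBy-equation : ∀ n e k →
    countBy s n e k ≡ countOneFreeBy s n e k + shiftedConv (countOneFreeBy s) (countBy s) n e k
  countBy-equation n e k =
    trans (sumWords-oneFree+containingOne n e (λ w → δ (s w) k))
          (cong (countOneFreeBy s n e k +_) (containingOne≡shiftedConv n))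
    where
    containingOne≡shiftedConv : ∀ n →
      sumContainingOne n e (λ w → δ (s w) k) ≡ shiftedConv (countOneFreeBy s) (countBy s) n e k
    containingOne≡shiftedConv zero    = refl
    containingOne≡shiftedConv (suc n) = sumAntidiag-cong n (λ j n′ _ →
      sumAntidiag-cong e (λ e₀ e′ _ → sumFirstOneAt-δ k j n′ e₀ e′))

-- The equation c = b + x b c determines b from c, and, being triangular in k, it does so
-- already for the coefficients with k ≤ K.
shiftedConv-cancel : ∀ K (b b′ c c′ : ℕ → ℕ → ℕ → ℕ) →
  (∀ n e k → c n e k ≡ b n e k + shiftedConv b c n e k) →
  (∀ n e k → c′ n e k ≡ b′ n e k + shiftedConv b′ c′ n e k) →
  (∀ n e k → k ≤ K → c n e k ≡ c′ n e k) →
  ∀ n e k → k ≤ K → b n e k ≡ b′ n e k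
shiftedConv-cancel K b b′ c c′ eq eq′ c≡c′ n = below n n ≤-refl
  where
  below : ∀ M n → n ≤ M → ∀ e k → k ≤ K → b n e k ≡ b′ n e k
  below M zero _ e k k≤K =
    +-cancelʳ-≡ 0 _ _ (trans (sym (eq 0 e k)) (trans (c≡c′ 0 e k k≤K) (eq′ 0 e k)))
  below (suc M) (suc n) (s≤s n≤M) e k k≤K =
    +-cancelʳ-≡ (shiftedConv b c (suc n) e k) _ _
      (trans (sym (eq (suc n) e k)) (trans (c≡c′ (suc n) e k k≤K)
        (trans (eq′ (suc n) e k) (cong (b′ (suc n) e k +_) (sym conv≡conv′)))))
    where
    conv≡conv′ : shiftedConv b c (suc n) e k ≡ shiftedConv b′ c′ (suc n) e k
    conv≡conv′ = sumAntidiag-cong n (λ j n′ j+n′≡n → sumAntidiag-cong e (λ e₀ e′ _ →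
      sumAntidiag-cong k (λ k₀ k₁ k₀+k₁≡k → cong₂ _*_
        (below M j (≤-trans (subst (j ≤_) j+n′≡n (m≤m+n j n′)) n≤M) e₀ k₀
          (≤-trans (subst (k₀ ≤_) k₀+k₁≡k (m≤m+n k₀ k₁)) k≤K))
        (c≡c′ n′ e′ k₁ (≤-trans (subst (k₁ ≤_) k₀+k₁≡k (m≤n+m k₁ k₀)) k≤K)))))

≤ᵇ-suc : ∀ b a → (suc b ≤ᵇ suc a) ≡ (b ≤ᵇ a)
≤ᵇ-suc zero    a = refl
≤ᵇ-suc (suc b) a = refl

dominates-⁺ : ∀ x y → dominates (x ⁺) (y ⁺) ≡ dominates x y
dominates-⁺ []      []      = refl
dominates-⁺ []      (b ∷ y) = refl
dominates-⁺ (a ∷ x) []      = refl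
dominates-⁺ (a ∷ x) (b ∷ y) = cong₂ _∧_ (≤ᵇ-suc b a) (dominates-⁺ x y)

dominatesPrefix-⁺ : ∀ u w →
  dominates (take (length (u ⁺)) (w ⁺)) (u ⁺) ≡ dominates (take (length u) w) u
dominatesPrefix-⁺ u w = begin
  dominates (take (length (u ⁺)) (w ⁺)) (u ⁺)
    ≡⟨ cong (λ L → dominates (take L (w ⁺)) (u ⁺)) (length-map suc u) ⟩
  dominates (take (length u) (w ⁺)) (u ⁺)
    ≡⟨ cong (λ v → dominates v (u ⁺)) (take-map (length u) w) ⟩
  dominates (take (length u) w ⁺) (u ⁺)
    ≡⟨ dominates-⁺ (take (length u) w) u ⟩
  dominates (take (length u) w) u ∎
  where open ≡-Reasoning

N-⁺ : ∀ u w → N (u ⁺) (w ⁺) ≡ N u w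
N-⁺ u []      = cong b2n (dominatesPrefix-⁺ u [])
N-⁺ u (a ∷ w) = cong₂ _+_ (cong b2n (dominatesPrefix-⁺ u (a ∷ w))) (N-⁺ u w)

dominatesPrefix-⁺-++-1∷ : ∀ u → All (1 ≤_) u → ∀ x y →
  dominates (take (length (u ⁺)) (x ++ 1 ∷ y)) (u ⁺) ≡ dominates (take (length (u ⁺)) x) (u ⁺)
dominatesPrefix-⁺-++-1∷ []          _               x       y = refl
dominatesPrefix-⁺-++-1∷ (suc b ∷ u) (s≤s z≤n ∷ 1≤u) []      y = refl
dominatesPrefix-⁺-++-1∷ (suc b ∷ u) (s≤s z≤n ∷ 1≤u) (a ∷ x) y =
  cong ((suc (suc b) ≤ᵇ a) ∧_) (dominatesPrefix-⁺-++-1∷ u 1≤u x y)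

N-⁺-++-1∷ : ∀ u → All (1 ≤_) u → ∀ w₀ w′ →
  N (u ⁺) (w₀ ++ 1 ∷ w′) ≡ N (u ⁺) w₀ + N (u ⁺) w′
N-⁺-++-1∷ u 1≤u []       w′ =
  cong (λ d → b2n d + N (u ⁺) w′) (dominatesPrefix-⁺-++-1∷ u 1≤u [] w′)
N-⁺-++-1∷ u 1≤u (a ∷ w₀) w′ =
  trans (cong₂ _+_ (cong b2n (dominatesPrefix-⁺-++-1∷ u 1≤u (a ∷ w₀) w′))
                   (N-⁺-++-1∷ u 1≤u w₀ w′))
        (sym (+-assoc (b2n (dominates (take (length (u ⁺)) (a ∷ w₀)) (u ⁺))) _ _))

countOneFreeBy-⁺ : ∀ u n e k → countOneFreeBy (N (u ⁺)) n (n + e) k ≡ countBy (N u) n e k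
countOneFreeBy-⁺ u n e k =
  trans (sumWords-oneFree-⁺ n e (λ w → δ (N (u ⁺) w) k))
        (sumWords-cong n e (λ w → cong (λ x → δ x k) (N-⁺ u w)))

sumEnum : ℕ → ℕ → (Word → ℕ) → ℕ
sumEnum n b f = sum (map f (wordsOf n b))

sumEnum-cong : ∀ n b {f g : Word → ℕ} → (∀ w → f w ≡ g w) → sumEnum n b f ≡ sumEnum n b g
sumEnum-cong n b H = cong sum (map-cong H (wordsOf n b))

sumBelow : ℕ → (ℕ → ℕ) → ℕ
sumBelow zero    ψ = 0
sumBelow (suc b) ψ = ψ 0 + sumBelow b (λ a → ψ (suc a))

sumBelow-zero : ∀ b {ψ : ℕ → ℕ} → (∀ a → ψ a ≡ 0) → sumBelow b ψ ≡ 0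
sumBelow-zero zero    H = refl
sumBelow-zero (suc b) H = cong₂ _+_ (H 0) (sumBelow-zero b (λ a → H (suc a)))

sum-applyUpTo : ∀ b ψ → sum (applyUpTo ψ b) ≡ sumBelow b ψ
sum-applyUpTo zero    ψ = refl
sum-applyUpTo (suc b) ψ = cong (ψ 0 +_) (sum-applyUpTo b (λ a → ψ (suc a)))

sumBelow-sumAntidiag : ∀ e b ψ F → e < b →
  (∀ a → a ≤ e → ψ a ≡ F a (e ∸ a)) → (∀ a → e < a → ψ a ≡ 0) →
  sumBelow b ψ ≡ sumAntidiag e F
sumBelow-sumAntidiag zero    (suc b) ψ F _         H≤ H> =
  trans (cong₂ _+_ (H≤ 0 z≤n) (sumBelow-zero b (λ a → H> (suc a) (s≤s z≤n)))) (+-identityʳ _)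
sumBelow-sumAntidiag (suc e) (suc b) ψ F (s≤s e<b) H≤ H> =
  cong₂ _+_ (H≤ 0 z≤n)
    (sumBelow-sumAntidiag e b _ _ e<b (λ a a≤e → H≤ (suc a) (s≤s a≤e))
                                      (λ a e<a → H> (suc a) (s≤s e<a)))

sum-map-concatMap : ∀ {A B : Set} (f : B → ℕ) (M : A → List B) xs →
  sum (map f (concatMap M xs)) ≡ sum (map (λ x → sum (map f (M x))) xs)
sum-map-concatMap f M []       = refl
sum-map-concatMap f M (x ∷ xs) = begin
  sum (map f (M x ++ concatMap M xs))              ≡⟨ cong sum (map-++ f (M x) _) ⟩
  sum (map f (M x) ++ map f (concatMap M xs))      ≡⟨ sum-++ (map f (M x)) _ ⟩
  sum (map f (M x)) + sum (map f (concatMap M xs)) ≡⟨ cong (sum (map f (M x)) +_) (sum-map-concatMap f M xs) ⟩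
  sum (map f (M x)) + sum (map (λ x → sum (map f (M x))) xs) ∎
  where open ≡-Reasoning

sumEnum-suc : ∀ n b f → sumEnum (suc n) b f ≡ sumBelow b (λ a → sumEnum n b (λ w → f (suc a ∷ w)))
sumEnum-suc n b f = begin
  sum (map f (concatMap (λ a → map (a ∷_) W) (map suc (upTo b))))
    ≡⟨ sum-map-concatMap f _ (map suc (upTo b)) ⟩
  sum (map (λ a → sum (map f (map (a ∷_) W))) (map suc (upTo b)))
    ≡⟨ cong sum (map-cong (λ a → cong sum (sym (map-∘ W))) (map suc (upTo b))) ⟩
  sum (map φ (map suc (upTo b)))
    ≡⟨ cong sum (sym (map-∘ (upTo b))) ⟩
  sum (map (λ a → φ (suc a)) (upTo b))
    ≡⟨ cong sum (map-upTo _ b) ⟩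
  sum (applyUpTo (λ a → φ (suc a)) b)
    ≡⟨ sum-applyUpTo b _ ⟩
  sumBelow b (λ a → sumEnum n b (λ w → f (suc a ∷ w))) ∎
  where
  open ≡-Reasoning
  W : List Word
  W = wordsOf n b
  φ : ℕ → ℕ
  φ a = sum (map (λ w → f (a ∷ w)) W)

-- The enumerated words of length n have letters ≥ 1, hence sum ≥ n.
sumEnum-vanish : ∀ n b f → (∀ w → n ≤ sum w → f w ≡ 0) → sumEnum n b f ≡ 0
sumEnum-vanish zero    b f H = cong (_+ 0) (H [] z≤n)
sumEnum-vanish (suc n) b f H = trans (sumEnum-suc n b f) (sumBelow-zero b (λ a →
  sumEnum-vanish n b _ (λ w n≤w → H (suc a ∷ w) (s≤s (≤-trans n≤w (m≤n+m (sum w) a))))))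

sumEnum-sumWords : ∀ n e b (g : Word → ℕ) → n + e ≤ b →
  sumEnum n b (λ w → δ (sum w) (n + e) * g w) ≡ sumWords n e g
sumEnum-sumWords zero    zero    b g _ = trans (+-identityʳ _) (+-identityʳ _)
sumEnum-sumWords zero    (suc e) b g _ = refl
sumEnum-sumWords (suc n) e       b g n+e<b =
  trans (sumEnum-suc n b _) (sumBelow-sumAntidiag e b _ _ e<b firstLetter≤e firstLetter>e)
  where
  e<b : e < b
  e<b = ≤-trans (s≤s (m≤n+m e n)) n+e<b
  firstLetter≤e : ∀ a → a ≤ e →
    sumEnum n b (λ w → δ (a + sum w) (n + e) * g (suc a ∷ w)) ≡
    sumWords n (e ∸ a) (λ w → g (suc a ∷ w))
  firstLetter≤e a a≤e =
    trans (sumEnum-cong n b (λ w → cong (_* g (suc a ∷ w)) (trans (cong (δ (a + sum w)) n+e≡a+n+[e∸a])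
                                                                  (δ-+-cancelˡ a (sum w) _))))
          (sumEnum-sumWords n (e ∸ a) b _
            (≤-trans (+-monoʳ-≤ n (m∸n≤m e a)) (≤-trans (n≤1+n _) n+e<b)))
    where
    n+e≡a+n+[e∸a] : n + e ≡ a + (n + (e ∸ a))
    n+e≡a+n+[e∸a] = trans (cong (n +_) (sym (m+[n∸m]≡n a≤e))) (+-exchangeˡ n a (e ∸ a))
  firstLetter>e : ∀ a → e < a → sumEnum n b (λ w → δ (a + sum w) (n + e) * g (suc a ∷ w)) ≡ 0
  firstLetter>e a e<a = sumEnum-vanish n b _ (λ w n≤w → cong (_* g (suc a ∷ w))
    (δ-< (a + sum w) (n + e) (subst (n + e <_) (+-comm (sum w) a) (+-mono-≤-< n≤w e<a))))

length-filterᵇ : ∀ {A : Set} (p : A → Bool) xs →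
                 length (filterᵇ p xs) ≡ sum (map (λ x → b2n (p x)) xs)
length-filterᵇ p []       = refl
length-filterᵇ p (x ∷ xs) with p x
... | true  = cong suc (length-filterᵇ p xs)
... | false = length-filterᵇ p xs

b2n-∧ : ∀ x y → b2n (x ∧ y) ≡ b2n x * b2n y
b2n-∧ true  y = sym (+-identityʳ _)
b2n-∧ false y = refl

coeff-sumEnum : ∀ u n m k → coeff u n m k ≡ sumEnum n m (λ w → δ (sum w) m * δ (N u w) k)
coeff-sumEnum u n m k =
  trans (length-filterᵇ _ (wordsOf n m)) (sumEnum-cong n m (λ w → b2n-∧ (sum w ≡ᵇ m) (N u w ≡ᵇ k)))

coeff-countBy : ∀ u n e k → coeff u n (n + e) k ≡ countBy (N u) n e k
coeff-countBy u n e k = trans (coeff-sumEnum u n (n + e) k) (sumEnum-sumWords n e (n + e) _ ≤-refl)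

coeff-< : ∀ u n m k → m < n → coeff u n m k ≡ 0
coeff-< u n m k m<n = trans (coeff-sumEnum u n m k) (sumEnum-vanish n m _ (λ w n≤w →
  cong (_* δ (N u w) k) (δ-< (sum w) m (<-≤-trans m<n n≤w))))

coeff-⁺-agree : ∀ u v → All (1 ≤_) u → All (1 ≤_) v → ∀ K →
  (∀ n m k → k ≤ K → coeff (u ⁺) n m k ≡ coeff (v ⁺) n m k) →
  ∀ n m k → k ≤ K → coeff u n m k ≡ coeff v n m k
coeff-⁺-agree u v 1≤u 1≤v K agree⁺ n m k k≤K with n ≤? m
... | no  n≰m = trans (coeff-< u n m k (≰⇒> n≰m)) (sym (coeff-< v n m k (≰⇒> n≰m)))
... | yes n≤m = subst (λ m → coeff u n m k ≡ coeff v n m k) (m+[n∸m]≡n n≤m) (agree (m ∸ n))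
  where
  open ≡-Reasoning
  count-agree : ∀ n e k → k ≤ K → countBy (N (u ⁺)) n e k ≡ countBy (N (v ⁺)) n e k
  count-agree n e k k≤K = begin
    countBy (N (u ⁺)) n e k ≡⟨ coeff-countBy (u ⁺) n e k ⟨
    coeff (u ⁺) n (n + e) k ≡⟨ agree⁺ n (n + e) k k≤K ⟩
    coeff (v ⁺) n (n + e) k ≡⟨ coeff-countBy (v ⁺) n e k ⟩
    countBy (N (v ⁺)) n e k ∎
  oneFree-agree : ∀ n e k → k ≤ K → countOneFreeBy (N (u ⁺)) n e k ≡ countOneFreeBy (N (v ⁺)) n e k
  oneFree-agree = shiftedConv-cancel K _ _ _ _
    (countBy-equation (N (u ⁺)) (N-⁺-++-1∷ u 1≤u))
    (countBy-equation (N (v ⁺)) (N-⁺-++-1∷ v 1≤v))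
    count-agree
  agree : ∀ e → coeff u n (n + e) k ≡ coeff v n (n + e) k
  agree e = begin
    coeff u n (n + e) k                  ≡⟨ coeff-countBy u n e k ⟩
    countBy (N u) n e k                  ≡⟨ countOneFreeBy-⁺ u n e k ⟨
    countOneFreeBy (N (u ⁺)) n (n + e) k ≡⟨ oneFree-agree n (n + e) k k≤K ⟩
    countOneFreeBy (N (v ⁺)) n (n + e) k ≡⟨ countOneFreeBy-⁺ v n e k ⟩
    countBy (N v) n e k                  ≡⟨ coeff-countBy v n e k ⟨
    coeff v n (n + e) k                  ∎

mainTheorem2 : (u v : Word) → All (1 ≤_) u → All (1 ≤_) v →
    (WilfEquiv (u ⁺) (v ⁺) → WilfEquiv u v)
    × (StronglyWilfEquiv (u ⁺) (v ⁺) → StronglyWilfEquiv u v)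
mainTheorem2 u v 1≤u 1≤v = wilf , strong
  where
  wilf : WilfEquiv (u ⁺) (v ⁺) → WilfEquiv u v
  wilf equiv⁺ n m = coeff-⁺-agree u v 1≤u 1≤v 0 (λ { n m _ z≤n → equiv⁺ n m }) n m 0 z≤n
  strong : StronglyWilfEquiv (u ⁺) (v ⁺) → StronglyWilfEquiv u v
  strong equiv⁺ n m k = coeff-⁺-agree u v 1≤u 1≤v k (λ n m k _ → equiv⁺ n m k) n m k ≤-refl
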